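{- For any positive integers $s,p,d$ and any $d$-ample $(s+2p,p)$-constellation $\mathcal C=(S_{\mathcal C},\mathcal L_{\mathcal C})$, there is a set $S\subseteq S_{\mathcal C}$ with $|S|=s$ such that $(S,\mathcal L_{\mathcal C})$ induces a $d$-ample $(s,p)$-constellation in which no vertex of $S$ has a neighbour in any path $P\in\mathcal L_{\mathcal C}$ at distance (measured in $P$) less than $d$ from an endpoint of $P$.
   Context: A constellation $\mathcal C=(S_{\mathcal C},\mathcal L_{\mathcal C})$ is a graph $\mathcal C$ together with an independent set $S_{\mathcal C}$ such that every connected component of $\mathcal C - S_{\mathcal C}$ is a path, $\mathcal L_{\mathcal C}$ is the set of these paths, and every vertex of $S_{\mathcal C}$ has at least one neighbour in each path of $\mathcal L_{\mathcal C}$. It is an $(s,p)$-constellation if $|S_{\mathcal C}|=s$ and $|\mathcal L_{\mathcal C}|=p$. For $S\subseteq S_{\mathcal C}$, $\mathcal L\subseteq\mathcal L_{\mathcal C}$, $(S,\mathcal L)$ denotes the constellation induced in $\mathcal C$ by $S$ and the vertices of the paths in $\mathcal L$. A $\mathcal C$-route is a path of $\mathcal C$ whose two endpoints are in $S_{\mathcal C}$ and whose internal vertices are not in $S_{\mathcal C}$. $\mathcal C$ is $d$-ample if there is no $\mathcal C$-route with at most $d+1$ edges. -}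

module Defs where

open import Data.Nat using (ℕ; zero; suc; _+_; _*_; _≤_; _<_)
open import Data.Bool using (Bool; true; false)
open import Data.Fin using (Fin; toℕ)
open import Data.Fin.Subset as Sub using (Subset)
open import Data.List using (List; []; _∷_; _++_; length; lookup)
open import Data.List.Membership.Propositional using (_∈_; _∉_)
open import Data.List.Relation.Unary.All using (All)
open import Data.List.Relation.Unary.Any using (Any)
open import Data.List.Relation.Unary.Linked using (Linked)
open import Data.List.Relation.Unary.Unique.Propositional using (Unique)
open import Data.Product using (Σ; _×_)
open import Data.Sum using (_⊎_)
open import Relation.Nullary using (¬_)
open import Relation.Binary.PropositionalEquality using (_≡_; _≢_)

record Graph (n : ℕ) : Set where
  field
    Adj    : Fin n → Fin n → Bool
    sym    : ∀ u v → Adj u v ≡ Adj v u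
    irrefl : ∀ v → Adj v v ≡ false

open Graph public

Edge : ∀ {n} → Graph n → Fin n → Fin n → Set
Edge G u v = Adj G u v ≡ true

_∈S_ : ∀ {n} → Fin n → Subset n → Set
v ∈S S = v Sub.∈ S

OnPaths : ∀ {n} → List (List (Fin n)) → Fin n → Set
OnPaths L v = Any (v ∈_) L

IsInducedPath : ∀ {n} → Graph n → List (Fin n) → Set
IsInducedPath G P =
  (P ≢ []) × Unique P ×
  (∀ (i j : Fin (length P)) → toℕ j ≡ suc (toℕ i) → Edge G (lookup P i) (lookup P j)) ×
  (∀ (i j : Fin (length P)) → Edge G (lookup P i) (lookup P j) →
       (toℕ j ≡ suc (toℕ i)) ⊎ (toℕ i ≡ suc (toℕ j)))

-- (S , L) is a constellation in the subgraph of G induced by S and the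
-- vertices of the paths in L: S independent, the paths of L are induced
-- paths, pairwise vertex-disjoint, disjoint from S, with no edges between
-- distinct paths (so they are exactly the components of the graph minus S),
-- and every vertex of S has a neighbour on every path of L.
record IsConstellation {n : ℕ} (G : Graph n) (S : Subset n)
                       (L : List (List (Fin n))) : Set where
  field
    independent : ∀ u v → u ∈S S → v ∈S S → ¬ Edge G u v
    paths       : All (IsInducedPath G) L
    disjointS   : ∀ v → v ∈S S → ¬ OnPaths L v
    disjointL   : ∀ (a b : Fin (length L)) → a ≢ b →
                    ∀ v → v ∈ lookup L a → v ∉ lookup L b
    noCross     : ∀ (a b : Fin (length L)) → a ≢ b →
                    ∀ u v → u ∈ lookup L a → v ∈ lookup L b → ¬ Edge G u v
    attached    : ∀ v → v ∈S S → All (λ P → Σ (Fin n) λ w → (w ∈ P) × Edge G v w) L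

Spanning : ∀ {n} → Subset n → List (List (Fin n)) → Set
Spanning {n} S L = ∀ (v : Fin n) → (v ∈S S) ⊎ OnPaths L v

-- Its number of edges is length I + 1.
record IsRoute {n : ℕ} (G : Graph n) (S : Subset n) (L : List (List (Fin n)))
               (u w : Fin n) (I : List (Fin n)) : Set where
  field
    u∈S      : u ∈S S
    w∈S      : w ∈S S
    u≢w      : u ≢ w
    internal : All (λ x → ¬ (x ∈S S) × OnPaths L x) I
    distinct : Unique (u ∷ I ++ w ∷ [])
    walk     : Linked (Edge G) (u ∷ I ++ w ∷ [])

Ample : ∀ {n} → Graph n → Subset n → List (List (Fin n)) → ℕ → Set
Ample {n} G S L d = ∀ (u w : Fin n) (I : List (Fin n)) →
  IsRoute G S L u w I → ¬ (suc (length I) ≤ suc d)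

-- No vertex of S has a neighbour on a path P of L at distance (in P) less
-- than d from an endpoint of P.  Position i in P (0-based) has distance
-- i from the first endpoint and length P - 1 - i from the last one.
FarFromEnds : ∀ {n} → Graph n → Subset n → List (List (Fin n)) → ℕ → Set
FarFromEnds G S L d =
  ∀ v → v ∈S S → All (λ P → ∀ (i : Fin (length P)) →
      (toℕ i < d) ⊎ (length P ≤ toℕ i + d) → ¬ Edge G v (lookup P i)) L

module Submission where

-- If distinct u, w ∈ S_C have neighbours at positions i ≤ j of one path P, then u, P[i..j], w
-- is a route with j − i + 2 edges, so d-ampleness forces j − i ≥ d.  Hence in each of the two
-- end-windows (d positions each) of each path at most one vertex of S_C has a neighbour.
-- Discarding these at most 2p vertices leaves at least s, and any subset of S_C spans, with the
-- same paths, a constellation that is still d-ample.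

open import Defs hiding (sym)
open import Data.Nat using (ℕ; zero; suc; _+_; _*_; _∸_; _≤_; _<_; z≤n; s≤s; _<?_; _≤?_)
open import Data.Nat.Properties
  using ( ≤-refl; ≤-reflexive; ≤-trans; ≤-total; ≤⇒≯; ≮⇒≥; n≤1+n; +-suc; +-identityʳ; +-cancelʳ-≤
        ; m∸n≤m; ∸-monoˡ-≤; m+n∸m≡n; +-∸-assoc; module ≤-Reasoning)
open import Data.Bool using (true)
import Data.Bool.Properties as Bool
open import Data.Fin using (Fin; toℕ; zero; suc)
import Data.Fin.Properties as Fin
open import Data.Fin.Subset using (Subset; ∣_∣; _⊆_; _-_; ⁅_⁆; ⊥; inside; outside)
open import Data.Fin.Subset.Properties
  using (p─⊥≡p; p─q⊆p; ⊆-refl; ⊆-trans; ⊆-min; ∣⊥∣≡0; s⊆s; _∈?_)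
open import Data.Vec.Base using ([]; _∷_; there)
open import Data.List using (List; []; _∷_; _++_; length; lookup; map)
open import Data.List.Properties using (length-++; length-map)
open import Data.List.Membership.Propositional using (_∈_)
open import Data.List.Relation.Unary.All as All using (All; []; _∷_)
import Data.List.Relation.Unary.All.Properties as All
open import Data.List.Relation.Unary.Any as Any using (here)
open import Data.List.Relation.Unary.Linked as Linked using (Linked; []; [-]; _∷_)
open import Data.List.Relation.Unary.AllPairs using ([]; _∷_)
open import Data.List.Relation.Unary.Unique.Propositional using (Unique)
import Data.List.Relation.Unary.Unique.Propositional.Properties as Unique
open import Data.Product using (Σ; ∃-syntax; _×_; _,_)
open import Data.Sum using (inj₁; inj₂; [_,_])
open import Data.Empty using (⊥-elim)
open import Level using (0ℓ)
open import Relation.Nullary using (¬_; yes; no)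
open import Relation.Nullary.Decidable using (_×-dec_)
open import Relation.Unary using (Pred; Decidable)
open import Relation.Binary.PropositionalEquality
  using (_≡_; _≢_; refl; sym; trans; cong; cong₂; subst; ≢-sym; module ≡-Reasoning)

x∉p-x : ∀ {n} (p : Subset n) x → ¬ x ∈S (p - x)
x∉p-x (b ∷ p) (suc x) (there x∈p-x) = x∉p-x p x x∈p-x

∣p∣≤1+∣p-x∣ : ∀ {n} (p : Subset n) x → ∣ p ∣ ≤ suc ∣ p - x ∣
∣p∣≤1+∣p-x∣ (inside  ∷ p) zero    = s≤s (≤-reflexive (cong ∣_∣ (sym (p─⊥≡p p))))
∣p∣≤1+∣p-x∣ (outside ∷ p) zero    = ≤-trans (n≤1+n _) (s≤s (≤-reflexive (cong ∣_∣ (sym (p─⊥≡p p)))))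
∣p∣≤1+∣p-x∣ (inside  ∷ p) (suc x) = s≤s (∣p∣≤1+∣p-x∣ p x)
∣p∣≤1+∣p-x∣ (outside ∷ p) (suc x) = ∣p∣≤1+∣p-x∣ p x

subset-of-size : ∀ {n s} (T : Subset n) → s ≤ ∣ T ∣ →
  Σ (Subset n) λ S → S ⊆ T × ∣ S ∣ ≡ s
subset-of-size {n} {zero} T _ = ⊥ , ⊆-min T , ∣⊥∣≡0 n
subset-of-size {s = suc s} (inside ∷ T) (s≤s s≤∣T∣) =
  let S , S⊆T , ∣S∣≡s = subset-of-size T s≤∣T∣
  in inside ∷ S , s⊆s S⊆T , cong suc ∣S∣≡s
subset-of-size {s = suc s} (outside ∷ T) s<∣T∣ =
  let S , S⊆T , ∣S∣≡s = subset-of-size T s<∣T∣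
  in outside ∷ S , s⊆s S⊆T , ∣S∣≡s

module _ {n : ℕ} where

  AtMostOneIn : Subset n → Pred (Fin n) 0ℓ → Set
  AtMostOneIn T B = ∀ {u v} → u ∈S T → v ∈S T → B u → B v → u ≡ v

  Avoids : Subset n → Pred (Fin n) 0ℓ → Set
  Avoids T B = ∀ {v} → v ∈S T → ¬ B v

  AtMostOneIn-⊆ : ∀ {T′ T B} → T′ ⊆ T → AtMostOneIn T B → AtMostOneIn T′ B
  AtMostOneIn-⊆ T′⊆T unique u∈T′ v∈T′ = unique (T′⊆T u∈T′) (T′⊆T v∈T′)

  remove-witness : ∀ (T : Subset n) {B} → Decidable B → AtMostOneIn T B →
    Σ (Subset n) λ T′ → T′ ⊆ T × ∣ T ∣ ≤ suc ∣ T′ ∣ × Avoids T′ B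
  remove-witness T B? unique with Fin.any? (λ v → v ∈? T ×-dec B? v)
  ... | yes (x , x∈T , Bx) = T - x , p─q⊆p T ⁅ x ⁆ , ∣p∣≤1+∣p-x∣ T x , avoids
    where
    avoids : Avoids (T - x) _
    avoids v∈T-x Bv =
      x∉p-x T x (subst (_∈S (T - x)) (unique (p─q⊆p T ⁅ x ⁆ v∈T-x) x∈T Bv Bx) v∈T-x)
  ... | no none = T , ⊆-refl , n≤1+n _ , λ v∈T Bv → none (_ , v∈T , Bv)

  remove-witnesses : ∀ (T : Subset n) (Bs : List (Pred (Fin n) 0ℓ)) →
    All Decidable Bs → All (AtMostOneIn T) Bs →
    Σ (Subset n) λ T′ → T′ ⊆ T × ∣ T ∣ ≤ ∣ T′ ∣ + length Bs × All (Avoids T′) Bs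
  remove-witnesses T [] [] [] = T , ⊆-refl , ≤-reflexive (sym (+-identityʳ _)) , []
  remove-witnesses T (B ∷ Bs) (B? ∷ Bs?) (uB ∷ uBs)
    with T₁ , T₁⊆T , ∣T∣≤1+∣T₁∣ , avoidB ← remove-witness T B? uB
    with T′ , T′⊆T₁ , ∣T₁∣≤ , avoidBs ← remove-witnesses T₁ Bs Bs? (All.map (AtMostOneIn-⊆ T₁⊆T) uBs)
    = T′ , ⊆-trans T′⊆T₁ T₁⊆T , count , (λ v∈T′ → avoidB (T′⊆T₁ v∈T′)) ∷ avoidBs
    where
    open ≤-Reasoning
    count : ∣ T ∣ ≤ ∣ T′ ∣ + suc (length Bs)
    count = begin
      ∣ T ∣                      ≤⟨ ∣T∣≤1+∣T₁∣ ⟩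
      suc ∣ T₁ ∣                 ≤⟨ s≤s ∣T₁∣≤ ⟩
      suc (∣ T′ ∣ + length Bs)   ≡⟨ +-suc ∣ T′ ∣ (length Bs) ⟨
      ∣ T′ ∣ + suc (length Bs)   ∎

  choose-avoiding : ∀ (T : Subset n) (Bs : List (Pred (Fin n) 0ℓ)) {s} →
    All Decidable Bs → All (AtMostOneIn T) Bs → s + length Bs ≤ ∣ T ∣ →
    Σ (Subset n) λ S → S ⊆ T × ∣ S ∣ ≡ s × All (Avoids S) Bs
  choose-avoiding T Bs {s} Bs? uBs s+k≤∣T∣ =
    let T′ , T′⊆T , ∣T∣≤∣T′∣+k , avoids = remove-witnesses T Bs Bs? uBs
        s≤∣T′∣ = +-cancelʳ-≤ (length Bs) s _ (≤-trans s+k≤∣T∣ ∣T∣≤∣T′∣+k)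
        S , S⊆T′ , ∣S∣≡s = subset-of-size T′ s≤∣T′∣
    in S , ⊆-trans S⊆T′ T′⊆T , ∣S∣≡s , All.map (λ avoid {v} v∈S → avoid (S⊆T′ v∈S)) avoids

module _ {A : Set} where

  slice : (P : List A) → ℕ → Fin (length P) → List A
  slice (a ∷ P) zero    zero    = a ∷ []
  slice (a ∷ P) zero    (suc j) = a ∷ slice P zero j
  slice (a ∷ P) (suc i) zero    = []
  slice (a ∷ P) (suc i) (suc j) = slice P i j

  length-slice : ∀ P i j → length (slice P i j) ≤ suc (toℕ j ∸ i)
  length-slice (a ∷ P) zero    zero    = ≤-refl
  length-slice (a ∷ P) zero    (suc j) = s≤s (length-slice P zero j)
  length-slice (a ∷ P) (suc i) zero    = z≤n
  length-slice (a ∷ P) (suc i) (suc j) = length-slice P i j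

  All-slice : ∀ {Q : Pred A 0ℓ} {P} i j → All Q P → All Q (slice P i j)
  All-slice {P = _ ∷ _} zero    zero    (qa ∷ _)  = qa ∷ []
  All-slice {P = _ ∷ _} zero    (suc j) (qa ∷ qP) = qa ∷ All-slice zero j qP
  All-slice {P = _ ∷ _} (suc i) zero    _         = []
  All-slice {P = _ ∷ _} (suc i) (suc j) (_ ∷ qP)  = All-slice i j qP

  Unique-slice : ∀ {P} i j → Unique P → Unique (slice P i j)
  Unique-slice {P = _ ∷ _} zero    zero    _           = [] ∷ []
  Unique-slice {P = _ ∷ _} zero    (suc j) (a∉P ∷ uP)  = All-slice zero j a∉P ∷ Unique-slice zero j uP
  Unique-slice {P = _ ∷ _} (suc i) zero    _           = []
  Unique-slice {P = _ ∷ _} (suc i) (suc j) (_ ∷ uP)    = Unique-slice i j uP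

  Linked-slice : ∀ {R : A → A → Set} {P x y} (i j : Fin (length P)) → toℕ i ≤ toℕ j →
    Linked R P → R x (lookup P i) → R (lookup P j) y →
    Linked R (x ∷ slice P (toℕ i) j ++ y ∷ [])
  Linked-slice {P = _ ∷ _}     zero    zero    _         _         xa ay = xa ∷ ay ∷ [-]
  Linked-slice {P = _ ∷ _ ∷ _} zero    (suc j) _         (ab ∷ lP) xa jy =
    xa ∷ Linked-slice zero j z≤n lP ab jy
  Linked-slice {P = _ ∷ _}     (suc i) (suc j) (s≤s i≤j) lP        xi jy =
    Linked-slice i j i≤j (Linked.tail lP) xi jy

  consecutive⇒Linked : ∀ {R : A → A → Set} (P : List A) →
    (∀ (i j : Fin (length P)) → toℕ j ≡ suc (toℕ i) → R (lookup P i) (lookup P j)) →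
    Linked R P
  consecutive⇒Linked []          _    = []
  consecutive⇒Linked (a ∷ [])    _    = [-]
  consecutive⇒Linked (a ∷ b ∷ P) next =
    next zero (suc zero) refl ∷
    consecutive⇒Linked (b ∷ P) λ i j j≡1+i → next (suc i) (suc j) (cong suc j≡1+i)

  Unique-flanked : ∀ {u w : A} {I} → u ≢ w → All (u ≢_) I → All (w ≢_) I → Unique I →
    Unique (u ∷ I ++ w ∷ [])
  Unique-flanked u≢w u∉I w∉I uI =
    All.++⁺ u∉I (u≢w ∷ []) ∷
    Unique.++⁺ uI ([] ∷ []) λ { (x∈I , here refl) → All.lookup w∉I x∈I refl }

Edge-sym : ∀ {n} (G : Graph n) {u v} → Edge G u v → Edge G v u
Edge-sym G {u} {v} uv = trans (Graph.sym G v u) uv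

NbrIn : ∀ {n} → Graph n → (P : List (Fin n)) → Pred (Fin (length P)) 0ℓ → Pred (Fin n) 0ℓ
NbrIn G P W v = ∃[ i ] W i × Edge G v (lookup P i)

NbrIn? : ∀ {n} (G : Graph n) P {W} → Decidable W → Decidable (NbrIn G P W)
NbrIn? G P W? v = Fin.any? λ i → W? i ×-dec (Adj G v (lookup P i) Bool.≟ true)

Narrow : ℕ → ∀ {m} → Pred (Fin m) 0ℓ → Set
Narrow d W = ∀ i j → W i → W j → toℕ i ≤ toℕ j → toℕ j ∸ toℕ i < d

initial-narrow : ∀ d {m} → Narrow d {m} λ i → toℕ i < d
initial-narrow d i j _ j<d _ = ≤-trans (s≤s (m∸n≤m (toℕ j) (toℕ i))) j<d

final-narrow : ∀ d {m} → Narrow d {m} λ i → m ≤ toℕ i + d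
final-narrow d {m} i j m≤i+d _ i≤j = begin
  suc (toℕ j ∸ toℕ i)   ≡⟨ +-∸-assoc 1 i≤j ⟨
  suc (toℕ j) ∸ toℕ i   ≤⟨ ∸-monoˡ-≤ (toℕ i) (≤-trans (Fin.toℕ<n j) m≤i+d) ⟩
  toℕ i + d ∸ toℕ i     ≡⟨ m+n∸m≡n (toℕ i) d ⟩
  d                     ∎
  where open ≤-Reasoning

module _ {n} (G : Graph n) (d : ℕ) where

  InitialNbr FinalNbr : List (Fin n) → Pred (Fin n) 0ℓ
  InitialNbr P = NbrIn G P λ i → toℕ i < d
  FinalNbr   P = NbrIn G P λ i → length P ≤ toℕ i + d

  EndNbrs : List (List (Fin n)) → List (Pred (Fin n) 0ℓ)
  EndNbrs L = map InitialNbr L ++ map FinalNbr L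

  length-EndNbrs : ∀ L → length (EndNbrs L) ≡ 2 * length L
  length-EndNbrs L = begin
    length (map InitialNbr L ++ map FinalNbr L)
      ≡⟨ length-++ (map InitialNbr L) ⟩
    length (map InitialNbr L) + length (map FinalNbr L)
      ≡⟨ cong₂ _+_ (length-map InitialNbr L) (length-map FinalNbr L) ⟩
    length L + length L
      ≡⟨ cong (length L +_) (+-identityʳ (length L)) ⟨
    2 * length L
      ∎
    where open ≡-Reasoning

  EndNbrs? : ∀ L → All Decidable (EndNbrs L)
  EndNbrs? L = All.++⁺ (All.map⁺ (All.universal (λ P → NbrIn? G P λ i → toℕ i <? d) L))
                       (All.map⁺ (All.universal (λ P → NbrIn? G P λ i → length P ≤? toℕ i + d) L))

  Avoids-EndNbrs⇒FarFromEnds : ∀ {S L} → All (Avoids S) (EndNbrs L) → FarFromEnds G S L d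
  Avoids-EndNbrs⇒FarFromEnds {L = L} avoids v v∈S =
    let initial , final = All.++⁻ (map InitialNbr L) avoids
    in All.zipWith (λ (avoids-initial , avoids-final) i →
         [ (λ i<d vi → avoids-initial v∈S (i , i<d , vi))
         , (λ i≥ vi → avoids-final v∈S (i , i≥ , vi)) ])
       (All.map⁻ initial , All.map⁻ final)

module _ {n} {G : Graph n} {S : Subset n} {L : List (List (Fin n))}
         (con : IsConstellation G S L) where

  open IsConstellation con

  All-OnPaths : ∀ {P} → P ∈ L → All (OnPaths L) P
  All-OnPaths P∈L = All.tabulate λ x∈P → Any.map (λ { refl → x∈P }) P∈L

  OnPaths⇒∉S : ∀ {x} → OnPaths L x → ¬ x ∈S S
  OnPaths⇒∉S x-on x∈S = disjointS _ x∈S x-on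

  slice-route : ∀ {P u w} → P ∈ L → u ∈S S → w ∈S S → u ≢ w →
    (i j : Fin (length P)) → toℕ i ≤ toℕ j →
    Edge G u (lookup P i) → Edge G w (lookup P j) →
    IsRoute G S L u w (slice P (toℕ i) j)
  slice-route {P} P∈L u∈S w∈S u≢w i j i≤j ui wj
    with _ , unique , consecutive , _ ← All.lookup paths P∈L = record
    { u∈S      = u∈S
    ; w∈S      = w∈S
    ; u≢w      = u≢w
    ; internal = All.map (λ x-on → OnPaths⇒∉S x-on , x-on) slice-on
    ; distinct = Unique-flanked u≢w (distinct-from u∈S) (distinct-from w∈S)
                                (Unique-slice (toℕ i) j unique)
    ; walk     = Linked-slice i j i≤j (consecutive⇒Linked P consecutive) ui (Edge-sym G wj)
    }
    where
    slice-on : All (OnPaths L) (slice P (toℕ i) j)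
    slice-on = All-slice (toℕ i) j (All-OnPaths P∈L)
    distinct-from : ∀ {v} → v ∈S S → All (v ≢_) (slice P (toℕ i) j)
    distinct-from v∈S = All.map (λ x-on v≡x → OnPaths⇒∉S x-on (subst (_∈S S) v≡x v∈S)) slice-on

  IsConstellation-⊆ : ∀ {S′} → S′ ⊆ S → IsConstellation G S′ L
  IsConstellation-⊆ S′⊆S = record
    { independent = λ u v u∈S′ v∈S′ → independent u v (S′⊆S u∈S′) (S′⊆S v∈S′)
    ; paths       = paths
    ; disjointS   = λ v v∈S′ → disjointS v (S′⊆S v∈S′)
    ; disjointL   = disjointL
    ; noCross     = noCross
    ; attached    = λ v v∈S′ → attached v (S′⊆S v∈S′)
    }

  module _ {d} (ample : Ample G S L d) where

    Ample-⊆ : ∀ {S′} → S′ ⊆ S → Ample G S′ L d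
    Ample-⊆ S′⊆S u w I route = ample u w I record
      { u∈S      = S′⊆S u∈S
      ; w∈S      = S′⊆S w∈S
      ; u≢w      = u≢w
      ; internal = All.map (λ (_ , x-on) → OnPaths⇒∉S x-on , x-on) internal
      ; distinct = distinct
      ; walk     = walk
      }
      where open IsRoute route

    attachments-far-apart : ∀ {P u w} → P ∈ L → u ∈S S → w ∈S S → u ≢ w →
      (i j : Fin (length P)) → toℕ i ≤ toℕ j →
      Edge G u (lookup P i) → Edge G w (lookup P j) → d ≤ toℕ j ∸ toℕ i
    attachments-far-apart {P} P∈L u∈S w∈S u≢w i j i≤j ui wj = ≮⇒≥ λ gap<d →
      ample _ _ _ (slice-route P∈L u∈S w∈S u≢w i j i≤j ui wj)
        (s≤s (≤-trans (length-slice P (toℕ i) j) gap<d))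

    narrow-window-unique : ∀ {P W} → P ∈ L → Narrow d W → AtMostOneIn S (NbrIn G P W)
    narrow-window-unique P∈L narrow {u} {v} u∈S v∈S (i , Wi , ui) (j , Wj , vj)
      with u Fin.≟ v | ≤-total (toℕ i) (toℕ j)
    ... | yes u≡v | _ = u≡v
    ... | no u≢v | inj₁ i≤j =
      ⊥-elim (≤⇒≯ (attachments-far-apart P∈L u∈S v∈S u≢v i j i≤j ui vj) (narrow i j Wi Wj i≤j))
    ... | no u≢v | inj₂ j≤i =
      ⊥-elim (≤⇒≯ (attachments-far-apart P∈L v∈S u∈S (≢-sym u≢v) j i j≤i vj ui) (narrow j i Wj Wi j≤i))

    EndNbrs-unique : All (AtMostOneIn S) (EndNbrs G d L)
    EndNbrs-unique =
      All.++⁺ (All.map⁺ (All.tabulate λ P∈L → narrow-window-unique P∈L (initial-narrow d)))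
              (All.map⁺ (All.tabulate λ P∈L → narrow-window-unique P∈L (final-narrow d)))

lemma2p1 : (s p d : ℕ) → 1 ≤ s → 1 ≤ p → 1 ≤ d →
    {n : ℕ} (G : Graph n) (SC : Subset n) (LC : List (List (Fin n))) →
    Spanning SC LC → IsConstellation G SC LC →
    ∣ SC ∣ ≡ s + 2 * p → length LC ≡ p → Ample G SC LC d →
    Σ (Subset n) λ S →
      (S ⊆ SC) × (∣ S ∣ ≡ s) × IsConstellation G S LC ×
      Ample G S LC d × FarFromEnds G S LC d
lemma2p1 s p d _ _ _ G SC LC _ con ∣SC∣≡s+2p ∣LC∣≡p ample =
  let S , S⊆SC , ∣S∣≡s , avoids =
        choose-avoiding SC (EndNbrs G d LC) (EndNbrs? G d LC) (EndNbrs-unique con ample) (≤-reflexive budget)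
  in S , S⊆SC , ∣S∣≡s , IsConstellation-⊆ con S⊆SC , Ample-⊆ con ample S⊆SC ,
     Avoids-EndNbrs⇒FarFromEnds G d avoids
  where
  open ≡-Reasoning
  budget : s + length (EndNbrs G d LC) ≡ ∣ SC ∣
  budget = begin
    s + length (EndNbrs G d LC) ≡⟨ cong (s +_) (length-EndNbrs G d LC) ⟩
    s + 2 * length LC           ≡⟨ cong (λ l → s + 2 * l) ∣LC∣≡p ⟩
    s + 2 * p                   ≡⟨ ∣SC∣≡s+2p ⟨
    ∣ SC ∣                      ∎
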